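{- Let $S^\star_{2n+2}$ be the double star consisting of two stars, each with a centre and $n$ leaves, with the two centres joined by an edge. Let $T$ be the time to complete discordant pull voting on $S^\star_{2n+2}$ (time until all vertices have the same colour). Then for any starting red/blue configuration, $\mathbf{E}\,T=O(n^4)$.
   Context: Pull discordant voting: each vertex holds colour red or blue; an edge is discordant if its endpoints have different colours, a vertex is discordant if incident to a discordant edge. At each step choose a discordant vertex $v$ uniformly at random among all discordant vertices and a discordant neighbour $u$ of $v$ uniformly at random; $v$ adopts the colour of $u$, all other colours unchanged. -}

module Defs where

open import Data.Bool using (Bool; true; false; _∧_; _∨_; not; _xor_; if_then_else_)
open import Data.Nat as ℕ using (ℕ; zero; suc; _≡ᵇ_; _≤ᵇ_)
open import Data.Fin using (Fin; toℕ; _≟_)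
open import Data.List using (List; []; _∷_; map; concatMap; filterᵇ; length; null; allFin; foldr)
open import Data.Bool.ListAction using (and)
open import Data.Product using (_×_; _,_; proj₁; proj₂)
open import Data.Integer using (+_)
open import Data.Rational using (ℚ; _/_; 0ℚ; 1ℚ; _+_; _*_)
open import Relation.Nullary.Decidable using (⌊_⌋)

-- A red/blue colouring of the vertex set Fin m (true = red, false = blue).
Config : ℕ → Set
Config m = Fin m → Bool

-- 1/k as a rational (k = 0 never occurs in use below).
inv : ℕ → ℚ
inv zero    = 0ℚ
inv (suc k) = + 1 / suc k

-- Discordant pull voting on a graph with vertex set Fin m and
-- (symmetric, loopless) adjacency given as a Boolean function.
module Voting {m : ℕ} (adj : Fin m → Fin m → Bool) where

  discNbrs : Config m → Fin m → List (Fin m)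
  discNbrs c v = filterᵇ (λ u → adj v u ∧ (c v xor c u)) (allFin m)

  discVerts : Config m → List (Fin m)
  discVerts c = filterᵇ (λ v → not (null (discNbrs c v))) (allFin m)

  update : Config m → Fin m → Bool → Config m
  update c v b w = if ⌊ w ≟ v ⌋ then b else c w

  stepWith : Config m → List (Fin m) → List (Config m × ℚ)
  stepWith c [] = (c , 1ℚ) ∷ []
  stepWith c D@(_ ∷ _) =
    concatMap (λ v → map (λ u → update c v (c u) , (inv (length D) * inv (length (discNbrs c v))))
                         (discNbrs c v)) D

  step : Config m → List (Config m × ℚ)
  step c = stepWith c (discVerts c)

  dist : ℕ → Config m → List (Config m × ℚ)
  dist zero c = (c , 1ℚ) ∷ []
  dist (suc t) c =
    concatMap (λ cp → map (λ cq → proj₁ cq , (proj₂ cp * proj₂ cq)) (step (proj₁ cp))) (dist t c)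

  mono : Config m → Bool
  mono c = and (map (λ u → and (map (λ v → not (c u xor c v)) (allFin m))) (allFin m))

  -- P(T > t) = P(state at time t is not monochromatic)
  -- (monochromatic states have no discordant vertex, hence are absorbing)
  tailProb : ℕ → Config m → ℚ
  tailProb t c = foldr (λ cp acc → (if mono (proj₁ cp) then 0ℚ else proj₂ cp) + acc) 0ℚ (dist t c)

  -- partial sum  Σ_{s < t} P(T > s);  E T = sup_t partialET t c
  partialET : ℕ → Config m → ℚ
  partialET zero c = 0ℚ
  partialET (suc t) c = partialET t c + tailProb t c

-- Double star S*_{2n+2} on vertex set Fin (2n+2):
-- 0, 1 are the two centres (joined by an edge); 2..n+1 are the leaves of
-- centre 0; n+2..2n+1 are the leaves of centre 1.
dsAdjℕ : ℕ → ℕ → ℕ → Bool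
dsAdjℕ n i j =
     ((i ≡ᵇ 0) ∧ (j ≡ᵇ 1)) ∨ ((i ≡ᵇ 1) ∧ (j ≡ᵇ 0))
  ∨ ((i ≡ᵇ 0) ∧ ((2 ≤ᵇ j) ∧ (j ≤ᵇ suc n))) ∨ ((j ≡ᵇ 0) ∧ ((2 ≤ᵇ i) ∧ (i ≤ᵇ suc n)))
  ∨ ((i ≡ᵇ 1) ∧ (suc (suc n) ≤ᵇ j)) ∨ ((j ≡ᵇ 1) ∧ (suc (suc n) ≤ᵇ i))

doubleStar : (n : ℕ) → Fin (suc (suc (n ℕ.+ n))) → Fin (suc (suc (n ℕ.+ n))) → Bool
doubleStar n i j = dsAdjℕ n (toℕ i) (toℕ j)

-- Call a leaf stray if its colour differs from its centre's, and
-- let a, b be the numbers of stray leaves at the two centres. Put Φ = K = 8(n+1)³ while the centres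
-- disagree and Φ = K (1 − 1/((a+1)(b+1))) + 2(a+b) while they agree. Every step of the chain lowers
-- 𝔼 Φ by at least 1 until the colouring is monochromatic: with agreeing centres, the rise of Φ when
-- a centre flips is cancelled exactly by the falls when its stray leaves flip; with disagreeing
-- centres, flipping a leaf leaves Φ at K while flipping a centre lowers it by at least
-- K/(n+1)² − 4n = 4n + 8, which pays for all 2n leaves.
-- As Φ ≥ 0, the partial sums Σ_{s<t} P(T > s) are bounded by the initial Φ ≤ K + 4n ≤ 68 n⁴.

module Submission where

module RationalArithmetic where
  open import Data.Bool using (Bool; true; false)
  open import Data.Nat as ℕ using (ℕ; zero; suc)
  import Data.Nat.Properties as ℕ
  open import Data.Integer as ℤ using (ℤ; +_)
  open import Data.Integer.Tactic.RingSolver using (solve-∀)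
  open import Data.Rational
  open import Data.Rational.Properties
  import Data.Rational.Unnormalised as ℚᵘ
  import Data.Rational.Unnormalised.Properties as ℚᵘ
  open import Data.Rational.Solver using (module +-*-Solver)
  open import Relation.Binary.PropositionalEquality
  open import Defs using (inv)

  open +-*-Solver

  toℚ : ℕ → ℚ
  toℚ zero    = 0ℚ
  toℚ (suc k) = 1ℚ + toℚ k

  toℚ-+ : ∀ m k → toℚ (m ℕ.+ k) ≡ toℚ m + toℚ k
  toℚ-+ zero    k = sym (+-identityˡ _)
  toℚ-+ (suc m) k = trans (cong (λ x → 1ℚ + x) (toℚ-+ m k)) (sym (+-assoc 1ℚ (toℚ m) (toℚ k)))

  toℚ-* : ∀ m k → toℚ (m ℕ.* k) ≡ toℚ m * toℚ k
  toℚ-* zero    k = sym (*-zeroˡ (toℚ k))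
  toℚ-* (suc m) k = begin
    toℚ (k ℕ.+ m ℕ.* k)    ≡⟨ toℚ-+ k (m ℕ.* k) ⟩
    toℚ k + toℚ (m ℕ.* k)  ≡⟨ cong (λ x → toℚ k + x) (toℚ-* m k) ⟩
    toℚ k + toℚ m * toℚ k  ≡⟨ solve 2 (λ x y → y :+ x :* y := (con 1ℚ :+ x) :* y) refl (toℚ m) (toℚ k) ⟩
    toℚ (suc m) * toℚ k    ∎
    where open ≡-Reasoning

  toℚᵘ-toℚ : ∀ k → toℚᵘ (toℚ k) ℚᵘ.≃ ℚᵘ.mkℚᵘ (+ k) 0
  toℚᵘ-toℚ zero    = ℚᵘ.*≡* refl
  toℚᵘ-toℚ (suc k) = ℚᵘ.≃-trans (toℚᵘ-homo-+ 1ℚ (toℚ k))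
    (ℚᵘ.≃-trans (ℚᵘ.+-congʳ (toℚᵘ 1ℚ) (toℚᵘ-toℚ k))
      (ℚᵘ.*≡* (unit-numerator (+ k))))
    where
    unit-numerator : ∀ (i : ℤ) → (+ 1 ℤ.+ i ℤ.* + 1) ℤ.* + 1 ≡ (+ 1 ℤ.+ i) ℤ.* + 1
    unit-numerator = solve-∀

  toℚ≡k/1 : ∀ k → toℚ k ≡ + k / 1
  toℚ≡k/1 k = toℚᵘ-injective (ℚᵘ.≃-trans (toℚᵘ-toℚ k) (ℚᵘ.≃-sym (toℚᵘ-fromℚᵘ (ℚᵘ.mkℚᵘ (+ k) 0))))

  toℚ*inv≡1 : ∀ k → toℚ (suc k) * inv (suc k) ≡ 1ℚ
  toℚ*inv≡1 k = toℚᵘ-injective (ℚᵘ.≃-trans (toℚᵘ-homo-* (toℚ (suc k)) (inv (suc k)))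
    (ℚᵘ.≃-trans (ℚᵘ.*-cong (toℚᵘ-toℚ (suc k)) (toℚᵘ-fromℚᵘ (ℚᵘ.mkℚᵘ (+ 1) k)))
      (ℚᵘ.*≡* (cong (λ z → + suc z) (trans (ℕ.*-identityʳ (k ℕ.* 1))
        (trans (ℕ.*-identityʳ k) (sym (trans (ℕ.+-identityʳ _) (ℕ.+-identityʳ k)))))))))

  +-nonNeg : ∀ {p q} → 0ℚ ≤ p → 0ℚ ≤ q → 0ℚ ≤ p + q
  +-nonNeg {p} {q} hp hq = subst (_≤ p + q) (+-identityˡ 0ℚ) (+-mono-≤ hp hq)

  *-nonNeg : ∀ {p q} → 0ℚ ≤ p → 0ℚ ≤ q → 0ℚ ≤ p * q
  *-nonNeg {p} {q} hp hq =
    nonNegative⁻¹ _ {{nonNeg*nonNeg⇒nonNeg p {{nonNegative hp}} q {{nonNegative hq}}}}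

  *-mono-≤-nonNeg : ∀ {p p′ q q′} → 0ℚ ≤ p → 0ℚ ≤ q → p ≤ p′ → q ≤ q′ → p * q ≤ p′ * q′
  *-mono-≤-nonNeg {p} {p′} {q} {q′} hp hq pp′ qq′ =
    ≤-trans (*-monoʳ-≤-nonNeg q {{nonNegative hq}} pp′)
            (*-monoˡ-≤-nonNeg p′ {{nonNegative (≤-trans hp pp′)}} qq′)

  ≤-by-slack : ∀ {p q} d → 0ℚ ≤ d → q ≡ p + d → p ≤ q
  ≤-by-slack {p} {q} d hd eq = subst₂ _≤_ (+-identityʳ p) (sym eq) (+-monoʳ-≤ p hd)

  p≤q⇒0≤q-p : ∀ {p q} → p ≤ q → 0ℚ ≤ q - p
  p≤q⇒0≤q-p {p} {q} h = subst (_≤ q - p) (+-inverseʳ p) (+-monoˡ-≤ (- p) h)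

  0≤1 : 0ℚ ≤ 1ℚ
  0≤1 = ≤ᵇ⇒≤ _

  toℚ-nonNeg : ∀ k → 0ℚ ≤ toℚ k
  toℚ-nonNeg zero    = ≤-refl
  toℚ-nonNeg (suc k) = +-nonNeg 0≤1 (toℚ-nonNeg k)

  toℚ-split : ∀ {k n} → k ℕ.≤ n → toℚ n ≡ toℚ k + toℚ (n ℕ.∸ k)
  toℚ-split {k} {n} k≤n = trans (cong toℚ (sym (ℕ.m+[n∸m]≡n k≤n))) (toℚ-+ k (n ℕ.∸ k))

  toℚ-mono-≤ : ∀ {k n} → k ℕ.≤ n → toℚ k ≤ toℚ n
  toℚ-mono-≤ {k} {n} k≤n = ≤-by-slack (toℚ (n ℕ.∸ k)) (toℚ-nonNeg (n ℕ.∸ k)) (toℚ-split k≤n)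

  inv-nonNeg : ∀ k → 0ℚ ≤ inv k
  inv-nonNeg zero    = ≤-refl
  inv-nonNeg (suc k) = nonNegative⁻¹ _ {{normalize-nonNeg 1 (suc k)}}

  -- An opaque copy of inv: kept as an atom, it stops Agda from unfolding the gcd
  -- normalisation inside 1/(k+1) when comparing potentials of different colourings.
  opaque
    recip : ℕ → ℚ
    recip = inv

    recip≡inv : ∀ k → recip k ≡ inv k
    recip≡inv k = refl

  toℚ*recip≡1 : ∀ k → toℚ (suc k) * recip (suc k) ≡ 1ℚ
  toℚ*recip≡1 k = trans (cong (toℚ (suc k) *_) (recip≡inv (suc k))) (toℚ*inv≡1 k)

  recip-nonNeg : ∀ k → 0ℚ ≤ recip k
  recip-nonNeg k = subst (0ℚ ≤_) (sym (recip≡inv k)) (inv-nonNeg k)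

  recip≤1 : ∀ k → recip (suc k) ≤ 1ℚ
  recip≤1 k = ≤-by-slack (toℚ k * recip (suc k)) (*-nonNeg (toℚ-nonNeg k) (recip-nonNeg (suc k)))
    (trans (sym (toℚ*recip≡1 k))
           (solve 2 (λ x r → (con 1ℚ :+ x) :* r := r :+ x :* r) refl (toℚ k) (recip (suc k))))

  recip-antimono : ∀ {k n} → k ℕ.≤ n → recip (suc n) ≤ recip (suc k)
  recip-antimono {k} {n} k≤n = ≤-by-slack (r′ * (d * r))
    (*-nonNeg (recip-nonNeg (suc n)) (*-nonNeg (toℚ-nonNeg (n ℕ.∸ k)) (recip-nonNeg (suc k))))
    (begin
      r                                   ≡⟨ sym (*-identityʳ r) ⟩
      r * 1ℚ                              ≡⟨ cong (r *_) (sym (toℚ*recip≡1 n)) ⟩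
      r * (toℚ (suc n) * r′)              ≡⟨ cong (λ z → r * ((1ℚ + z) * r′)) (toℚ-split k≤n) ⟩
      r * ((1ℚ + (toℚ k + d)) * r′)
        ≡⟨ solve 4 (λ a b x y → a :* ((con 1ℚ :+ (x :+ y)) :* b) := b :* ((con 1ℚ :+ x) :* a) :+ b :* (y :* a))
             refl r r′ (toℚ k) d ⟩
      r′ * (toℚ (suc k) * r) + r′ * (d * r)  ≡⟨ cong (λ z → r′ * z + r′ * (d * r)) (toℚ*recip≡1 k) ⟩
      r′ * 1ℚ + r′ * (d * r)              ≡⟨ cong (_+ r′ * (d * r)) (*-identityʳ r′) ⟩
      r′ + r′ * (d * r)                   ∎)
    where
    open ≡-Reasoning
    d : ℚ
    d = toℚ (n ℕ.∸ k)
    r r′ : ℚ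
    r  = recip (suc k)
    r′ = recip (suc n)

  keepIf : Bool → ℚ → ℚ
  keepIf true  x = x
  keepIf false _ = 0ℚ

  K : ℕ → ℚ
  K n = toℚ 8 * (toℚ (suc n) * (toℚ (suc n) * toℚ (suc n)))

  K-nonNeg : ∀ n → 0ℚ ≤ K n
  K-nonNeg n = *-nonNeg (toℚ-nonNeg 8)
    (*-nonNeg (toℚ-nonNeg (suc n)) (*-nonNeg (toℚ-nonNeg (suc n)) (toℚ-nonNeg (suc n))))

  -- The potential of a colouring whose two centres agree and have a and b stray leaves;
  -- colourings whose centres disagree get potential K n.
  agreePotential : ℕ → ℕ → ℕ → ℚ
  agreePotential n a b = K n - K n * (recip (suc a) * recip (suc b)) + toℚ 2 * (toℚ a + toℚ b)

  agreePotential-sym : ∀ n a b → agreePotential n a b ≡ agreePotential n b a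
  agreePotential-sym n a b =
    solve 5 (λ k x y α β → k :- k :* (α :* β) :+ con (toℚ 2) :* (x :+ y) := k :- k :* (β :* α) :+ con (toℚ 2) :* (y :+ x))
      refl (K n) (toℚ a) (toℚ b) (recip (suc a)) (recip (suc b))

  leaves-drift : ∀ n a b →
    toℚ (suc a) * (agreePotential n a b - agreePotential n (suc a) b + 1ℚ)
      ≡ - (K n * (recip (suc (suc a)) * recip (suc b))) - toℚ (suc a)
  leaves-drift n a b = begin
    toℚ (suc a) * (agreePotential n a b - agreePotential n (suc a) b + 1ℚ)
      ≡⟨ solve 6 (λ k x y α′ α β →
           (con 1ℚ :+ x) :* ((k :- k :* (α′ :* β) :+ con (toℚ 2) :* (x :+ y)) :- (k :- k :* (α :* β) :+ con (toℚ 2) :* ((con 1ℚ :+ x) :+ y)) :+ con 1ℚ)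
           := :- (k :* β) :* ((con 1ℚ :+ x) :* α′) :+ (k :* β) :* ((con 1ℚ :+ (con 1ℚ :+ x)) :* α) :- k :* (α :* β) :- (con 1ℚ :+ x))
           refl (K n) (toℚ a) (toℚ b) ra ra′ rb ⟩
    - (K n * rb) * (toℚ (suc a) * ra) + (K n * rb) * (toℚ (suc (suc a)) * ra′) - K n * (ra′ * rb) - toℚ (suc a)
      ≡⟨ cong₂ (λ u v → - (K n * rb) * u + (K n * rb) * v - K n * (ra′ * rb) - toℚ (suc a)) (toℚ*recip≡1 a) (toℚ*recip≡1 (suc a)) ⟩
    - (K n * rb) * 1ℚ + (K n * rb) * 1ℚ - K n * (ra′ * rb) - toℚ (suc a)
      ≡⟨ solve 3 (λ k q x → :- k :* con 1ℚ :+ k :* con 1ℚ :- q :- x := :- q :- x) refl (K n * rb) (K n * (ra′ * rb)) (toℚ (suc a)) ⟩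
    - (K n * (ra′ * rb)) - toℚ (suc a) ∎
    where
    open ≡-Reasoning
    ra ra′ rb : ℚ
    ra  = recip (suc a)
    ra′ = recip (suc (suc a))
    rb  = recip (suc b)

  -- Flipping the centre raises the potential by K/((a+1)(b+1)) − 2(a+b); flipping each of its a
  -- stray leaves lowers it by K/(a(a+1)(b+1)) + 2, so the K-terms cancel in the sum.
  star-drift : ∀ n a b (d : Bool) → (d ≡ true → 1 ℕ.≤ a) →
    keepIf d (K n - agreePotential n a b + 1ℚ)
      + toℚ a * (agreePotential n (a ℕ.∸ 1) b - agreePotential n a b + 1ℚ) ≤ 0ℚ
  star-drift n zero b true h with () ← h refl
  star-drift n zero b false h =
    ≤-reflexive (trans (+-identityˡ _) (*-zeroˡ (agreePotential n 0 b - agreePotential n 0 b + 1ℚ)))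
  star-drift n (suc a) b true h = ≤-by-slack (toℚ 2 * (toℚ (suc a) + toℚ b) + toℚ a)
    (+-nonNeg (*-nonNeg (toℚ-nonNeg 2) (+-nonNeg (toℚ-nonNeg (suc a)) (toℚ-nonNeg b))) (toℚ-nonNeg a))
    (sym (trans (cong (λ z → K n - agreePotential n (suc a) b + 1ℚ + z + (toℚ 2 * (toℚ (suc a) + toℚ b) + toℚ a))
                      (leaves-drift n a b))
      (solve 5 (λ k x y α β →
         k :- (k :- k :* (α :* β) :+ con (toℚ 2) :* ((con 1ℚ :+ x) :+ y)) :+ con 1ℚ :+ (:- (k :* (α :* β)) :- (con 1ℚ :+ x))
           :+ (con (toℚ 2) :* ((con 1ℚ :+ x) :+ y) :+ x) := con 0ℚ)
         refl (K n) (toℚ a) (toℚ b) (recip (suc (suc a))) (recip (suc b)))))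
  star-drift n (suc a) b false h = ≤-by-slack (K n * (recip (suc (suc a)) * recip (suc b)) + toℚ (suc a))
    (+-nonNeg (*-nonNeg (K-nonNeg n) (*-nonNeg (recip-nonNeg (suc (suc a))) (recip-nonNeg (suc b)))) (toℚ-nonNeg (suc a)))
    (sym (trans (cong (λ z → 0ℚ + z + (K n * (recip (suc (suc a)) * recip (suc b)) + toℚ (suc a))) (leaves-drift n a b))
      (solve 2 (λ q x → con 0ℚ :+ (:- q :- x) :+ (q :+ x) := con 0ℚ) refl
         (K n * (recip (suc (suc a)) * recip (suc b))) (toℚ (suc a)))))

  agree-drift : ∀ n a b (d₀ d₁ : Bool) → (d₀ ≡ true → 1 ℕ.≤ a) → (d₁ ≡ true → 1 ℕ.≤ b) →
    keepIf d₀ (K n - agreePotential n a b + 1ℚ) + (keepIf d₁ (K n - agreePotential n a b + 1ℚ)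
      + (toℚ a * (agreePotential n (a ℕ.∸ 1) b - agreePotential n a b + 1ℚ)
         + toℚ b * (agreePotential n a (b ℕ.∸ 1) - agreePotential n a b + 1ℚ))) ≤ 0ℚ
  agree-drift n a b d₀ d₁ h₀ h₁ = subst₂ _≤_ regroup (+-identityˡ 0ℚ) (+-mono-≤ (star-drift n a b d₀ h₀) star₁)
    where
    X T₀ T₁ : ℚ
    X  = K n - agreePotential n a b + 1ℚ
    T₀ = agreePotential n (a ℕ.∸ 1) b - agreePotential n a b + 1ℚ
    T₁ = agreePotential n a (b ℕ.∸ 1) - agreePotential n a b + 1ℚ
    star₁ : keepIf d₁ X + toℚ b * T₁ ≤ 0ℚ
    star₁ = subst₂ (λ u v → keepIf d₁ (K n - u + 1ℚ) + toℚ b * (v - u + 1ℚ) ≤ 0ℚ)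
              (agreePotential-sym n b a) (agreePotential-sym n (b ℕ.∸ 1) a) (star-drift n b a d₁ h₁)
    regroup : (keepIf d₀ X + toℚ a * T₀) + (keepIf d₁ X + toℚ b * T₁)
                ≡ keepIf d₀ X + (keepIf d₁ X + (toℚ a * T₀ + toℚ b * T₁))
    regroup = solve 4 (λ p q r s → (p :+ r) :+ (q :+ s) := p :+ (q :+ (r :+ s))) refl
      (keepIf d₀ X) (keepIf d₁ X) (toℚ a * T₀) (toℚ b * T₁)

  K/[n+1]²≡8[n+1] : ∀ n → K n * (recip (suc n) * recip (suc n)) ≡ toℚ 8 * toℚ (suc n)
  K/[n+1]²≡8[n+1] n = begin
    K n * (r * r)                                ≡⟨ solve 3 (λ e x i → e :* (x :* (x :* x)) :* (i :* i) := e :* x :* (x :* i) :* (x :* i)) refl (toℚ 8) N r ⟩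
    toℚ 8 * N * (N * r) * (N * r)                ≡⟨ cong (λ z → toℚ 8 * N * z * z) (toℚ*recip≡1 n) ⟩
    toℚ 8 * N * 1ℚ * 1ℚ                          ≡⟨ solve 2 (λ e x → e :* x :* con 1ℚ :* con 1ℚ := e :* x) refl (toℚ 8) N ⟩
    toℚ 8 * N                                    ∎
    where
    open ≡-Reasoning
    N r : ℚ
    N = toℚ (suc n)
    r = recip (suc n)

  agreePotential-nonNeg : ∀ n a b → 0ℚ ≤ agreePotential n a b
  agreePotential-nonNeg n a b = ≤-by-slack (K n * (1ℚ - q) + toℚ 2 * (toℚ a + toℚ b))
    (+-nonNeg (*-nonNeg (K-nonNeg n) (p≤q⇒0≤q-p q≤1)) (*-nonNeg (toℚ-nonNeg 2) (+-nonNeg (toℚ-nonNeg a) (toℚ-nonNeg b))))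
    (solve 4 (λ k q x y → k :- k :* q :+ con (toℚ 2) :* (x :+ y) := con 0ℚ :+ (k :* (con 1ℚ :- q) :+ con (toℚ 2) :* (x :+ y)))
       refl (K n) q (toℚ a) (toℚ b))
    where
    q : ℚ
    q = recip (suc a) * recip (suc b)
    q≤1 : q ≤ 1ℚ
    q≤1 = subst (q ≤_) (*-identityʳ 1ℚ)
            (*-mono-≤-nonNeg (recip-nonNeg (suc a)) (recip-nonNeg (suc b)) (recip≤1 a) (recip≤1 b))

  agreePotential≤ : ∀ n a b → a ℕ.≤ n → b ℕ.≤ n → agreePotential n a b ≤ K n + toℚ 2 * (toℚ n + toℚ n)
  agreePotential≤ n a b a≤n b≤n = ≤-by-slack (K n * q + toℚ 2 * ((toℚ n - toℚ a) + (toℚ n - toℚ b)))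
    (+-nonNeg (*-nonNeg (K-nonNeg n) (*-nonNeg (recip-nonNeg (suc a)) (recip-nonNeg (suc b))))
              (*-nonNeg (toℚ-nonNeg 2) (+-nonNeg (p≤q⇒0≤q-p (toℚ-mono-≤ a≤n)) (p≤q⇒0≤q-p (toℚ-mono-≤ b≤n)))))
    (solve 5 (λ k q x y m → k :+ con (toℚ 2) :* (m :+ m)
                := (k :- k :* q :+ con (toℚ 2) :* (x :+ y)) :+ (k :* q :+ con (toℚ 2) :* ((m :- x) :+ (m :- y))))
       refl (K n) q (toℚ a) (toℚ b) (toℚ n))
    where
    q : ℚ
    q = recip (suc a) * recip (suc b)

  -- The factor K/((a+1)(b+1)) ≥ K/(n+1)² = 8(n+1) keeps agreeing states well below K.
  agreePotential≤K-8[n+1] : ∀ n a b → a ℕ.≤ n → b ℕ.≤ n →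
    agreePotential n a b ≤ K n - toℚ 8 * toℚ (suc n) + toℚ 2 * (toℚ n + toℚ n)
  agreePotential≤K-8[n+1] n a b a≤n b≤n =
    ≤-by-slack ((K n * q - K n * r²) + toℚ 2 * ((toℚ n - toℚ a) + (toℚ n - toℚ b)))
      (+-nonNeg (p≤q⇒0≤q-p (*-monoˡ-≤-nonNeg (K n) {{nonNegative (K-nonNeg n)}}
                  (*-mono-≤-nonNeg (recip-nonNeg (suc n)) (recip-nonNeg (suc n)) (recip-antimono a≤n) (recip-antimono b≤n))))
                (*-nonNeg (toℚ-nonNeg 2) (+-nonNeg (p≤q⇒0≤q-p (toℚ-mono-≤ a≤n)) (p≤q⇒0≤q-p (toℚ-mono-≤ b≤n)))))
      (trans (cong (λ z → K n - z + toℚ 2 * (toℚ n + toℚ n)) (sym (K/[n+1]²≡8[n+1] n)))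
        (solve 6 (λ k q r x y m → k :- k :* r :+ con (toℚ 2) :* (m :+ m) :=
             (k :- k :* q :+ con (toℚ 2) :* (x :+ y)) :+ ((k :* q :- k :* r) :+ con (toℚ 2) :* ((m :- x) :+ (m :- y))))
           refl (K n) q r² (toℚ a) (toℚ b) (toℚ n)))
    where
    q r² : ℚ
    q  = recip (suc a) * recip (suc b)
    r² = recip (suc n) * recip (suc n)

  disagree-drift : ∀ n u₀ u₁ s₀ s₁ →
    u₀ ≤ K n - toℚ 8 * toℚ (suc n) + toℚ 2 * (toℚ n + toℚ n) →
    u₁ ≤ K n - toℚ 8 * toℚ (suc n) + toℚ 2 * (toℚ n + toℚ n) →
    s₀ ≤ toℚ n → s₁ ≤ toℚ n →
    (u₀ - K n + 1ℚ) + ((u₁ - K n + 1ℚ) + (s₀ + s₁)) ≤ 0ℚ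
  disagree-drift n u₀ u₁ s₀ s₁ h₀ h₁ h₂ h₃ = ≤-trans
    (+-mono-≤ (+-monoˡ-≤ 1ℚ (+-monoˡ-≤ (- K n) h₀))
              (+-mono-≤ (+-monoˡ-≤ 1ℚ (+-monoˡ-≤ (- K n) h₁)) (+-mono-≤ h₂ h₃)))
    (≤-by-slack (toℚ 14 + toℚ 6 * toℚ n) (+-nonNeg (toℚ-nonNeg 14) (*-nonNeg (toℚ-nonNeg 6) (toℚ-nonNeg n)))
      (sym (solve 2 (λ k m → (k :- con (toℚ 8) :* (con 1ℚ :+ m) :+ con (toℚ 2) :* (m :+ m) :- k :+ con 1ℚ)
                   :+ ((k :- con (toℚ 8) :* (con 1ℚ :+ m) :+ con (toℚ 2) :* (m :+ m) :- k :+ con 1ℚ) :+ (m :+ m))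
                   :+ (con (toℚ 14) :+ con (toℚ 6) :* m) := con 0ℚ) refl (K n) (toℚ n))))

  K+4n≤68n⁴ : ∀ m → K (suc m) + toℚ 2 * (toℚ (suc m) + toℚ (suc m)) ≤ + (68 ℕ.* suc m ℕ.^ 4) / 1
  K+4n≤68n⁴ m = subst (K (suc m) + toℚ 2 * (toℚ (suc m) + toℚ (suc m)) ≤_) (trans 68n⁴≡ (toℚ≡k/1 (68 ℕ.* suc m ℕ.^ 4)))
    (≤-by-slack (toℚ 68 * (x * x * x * x) + toℚ 264 * (x * x * x) + toℚ 360 * (x * x) + toℚ 172 * x)
      (+-nonNeg (+-nonNeg (+-nonNeg (*-nonNeg (toℚ-nonNeg 68) (*-nonNeg (*-nonNeg (*-nonNeg x≥0 x≥0) x≥0) x≥0))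
                                    (*-nonNeg (toℚ-nonNeg 264) (*-nonNeg (*-nonNeg x≥0 x≥0) x≥0)))
                          (*-nonNeg (toℚ-nonNeg 360) (*-nonNeg x≥0 x≥0)))
                (*-nonNeg (toℚ-nonNeg 172) x≥0))
      (solve 1 (λ y → con (toℚ 68) :* ((con 1ℚ :+ y) :* ((con 1ℚ :+ y) :* ((con 1ℚ :+ y) :* ((con 1ℚ :+ y) :* con 1ℚ))))
         := (con (toℚ 8) :* ((con 1ℚ :+ (con 1ℚ :+ y)) :* ((con 1ℚ :+ (con 1ℚ :+ y)) :* (con 1ℚ :+ (con 1ℚ :+ y))))
               :+ con (toℚ 2) :* ((con 1ℚ :+ y) :+ (con 1ℚ :+ y)))
            :+ (con (toℚ 68) :* (y :* y :* y :* y) :+ con (toℚ 264) :* (y :* y :* y) :+ con (toℚ 360) :* (y :* y) :+ con (toℚ 172) :* y))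
         refl x))
    where
    x N : ℚ
    x = toℚ m
    N = toℚ (suc m)
    x≥0 : 0ℚ ≤ x
    x≥0 = toℚ-nonNeg m
    68n⁴≡ : toℚ 68 * (N * (N * (N * (N * toℚ 1)))) ≡ toℚ (68 ℕ.* suc m ℕ.^ 4)
    68n⁴≡ = sym (begin
      toℚ (68 ℕ.* suc m ℕ.^ 4)                      ≡⟨ toℚ-* 68 (suc m ℕ.^ 4) ⟩
      toℚ 68 * toℚ (suc m ℕ.^ 4)                    ≡⟨ cong (toℚ 68 *_) (toℚ-* (suc m) (suc m ℕ.^ 3)) ⟩
      toℚ 68 * (N * toℚ (suc m ℕ.^ 3))              ≡⟨ cong (λ z → toℚ 68 * (N * z)) (toℚ-* (suc m) (suc m ℕ.^ 2)) ⟩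
      toℚ 68 * (N * (N * toℚ (suc m ℕ.^ 2)))        ≡⟨ cong (λ z → toℚ 68 * (N * (N * z))) (toℚ-* (suc m) (suc m ℕ.^ 1)) ⟩
      toℚ 68 * (N * (N * (N * toℚ (suc m ℕ.^ 1))))  ≡⟨ cong (λ z → toℚ 68 * (N * (N * (N * z)))) (toℚ-* (suc m) 1) ⟩
      toℚ 68 * (N * (N * (N * (N * toℚ 1))))        ∎)
      where open ≡-Reasoning

module FiniteSums where
  open import Data.Bool using (Bool; true; false; if_then_else_; _∨_; not)
  open import Data.Bool.Properties using (∨-assoc)
  open import Data.Nat as ℕ using (ℕ; zero; suc; z≤n; s≤s)
  import Data.Nat.Properties as ℕ
  open import Data.Fin using (Fin; zero; suc; _↑ˡ_; _↑ʳ_)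
  open import Data.Fin.Properties using (suc-injective)
  open import Data.List using (List; []; _∷_; foldr; concatMap; _++_; length; tabulate; filterᵇ; null)
  open import Data.List.Relation.Unary.All using (All; []; _∷_)
  open import Data.Rational
  open import Data.Rational.Properties
  open import Data.Rational.Solver using (module +-*-Solver)
  open import Function using (_∘_)
  open import Relation.Binary.PropositionalEquality
  open import Relation.Nullary using (¬_)
  open RationalArithmetic

  open +-*-Solver

  sumMap : {A : Set} → (A → ℚ) → List A → ℚ
  sumMap g = foldr (λ x acc → g x + acc) 0ℚ

  sumᶠ : ∀ k → (Fin k → ℚ) → ℚ
  sumᶠ zero    h = 0ℚ
  sumᶠ (suc k) h = h zero + sumᶠ k (h ∘ suc)

  anyᶠ : ∀ k → (Fin k → Bool) → Bool
  anyᶠ zero    p = false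
  anyᶠ (suc k) p = p zero ∨ anyᶠ k (p ∘ suc)

  countᶠ : ∀ k → (Fin k → Bool) → ℕ
  countᶠ zero    p = 0
  countᶠ (suc k) p = (if p zero then 1 else 0) ℕ.+ countᶠ k (p ∘ suc)

  sumMap-filter-tabulate : ∀ {A : Set} k (g : Fin k → A) (p : A → Bool) (h : A → ℚ) →
    sumMap h (filterᵇ p (tabulate g)) ≡ sumᶠ k (λ i → keepIf (p (g i)) (h (g i)))
  sumMap-filter-tabulate zero    g p h = refl
  sumMap-filter-tabulate (suc k) g p h with p (g zero)
  ... | true  = cong (h (g zero) +_) (sumMap-filter-tabulate k (g ∘ suc) p h)
  ... | false = trans (sumMap-filter-tabulate k (g ∘ suc) p h) (sym (+-identityˡ _))

  nonNull-filter-tabulate : ∀ {A : Set} k (g : Fin k → A) (p : A → Bool) →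
    not (null (filterᵇ p (tabulate g))) ≡ anyᶠ k (p ∘ g)
  nonNull-filter-tabulate zero    g p = refl
  nonNull-filter-tabulate (suc k) g p with p (g zero)
  ... | true  = refl
  ... | false = nonNull-filter-tabulate k (g ∘ suc) p

  filter-tabulate≡[] : ∀ {A : Set} k (g : Fin k → A) (p : A → Bool) →
    filterᵇ p (tabulate g) ≡ [] → ∀ i → p (g i) ≡ false
  filter-tabulate≡[] (suc k) g p e i with p (g zero) in eq
  filter-tabulate≡[] (suc k) g p () i       | true
  filter-tabulate≡[] (suc k) g p e zero    | false = eq
  filter-tabulate≡[] (suc k) g p e (suc i) | false = filter-tabulate≡[] k (g ∘ suc) p e i

  sumᶠ-cong : ∀ k {g h : Fin k → ℚ} → (∀ i → g i ≡ h i) → sumᶠ k g ≡ sumᶠ k h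
  sumᶠ-cong zero    e = refl
  sumᶠ-cong (suc k) e = cong₂ _+_ (e zero) (sumᶠ-cong k (e ∘ suc))

  sumᶠ-mono-≤ : ∀ k {g h : Fin k → ℚ} → (∀ i → g i ≤ h i) → sumᶠ k g ≤ sumᶠ k h
  sumᶠ-mono-≤ zero    e = ≤-refl
  sumᶠ-mono-≤ (suc k) e = +-mono-≤ (e zero) (sumᶠ-mono-≤ k (e ∘ suc))

  sumᶠ-+ : ∀ a b (h : Fin (a ℕ.+ b) → ℚ) → sumᶠ (a ℕ.+ b) h ≡ sumᶠ a (h ∘ (_↑ˡ b)) + sumᶠ b (h ∘ (a ↑ʳ_))
  sumᶠ-+ zero    b h = sym (+-identityˡ _)
  sumᶠ-+ (suc a) b h = trans (cong (h zero +_) (sumᶠ-+ a b (h ∘ suc)))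
    (sym (+-assoc (h zero) (sumᶠ a (h ∘ suc ∘ (_↑ˡ b))) (sumᶠ b (h ∘ suc ∘ (a ↑ʳ_)))))

  sumᶠ-keepIf : ∀ k (p : Fin k → Bool) x → sumᶠ k (λ i → keepIf (p i) x) ≡ toℚ (countᶠ k p) * x
  sumᶠ-keepIf zero    p x = sym (*-zeroˡ x)
  sumᶠ-keepIf (suc k) p x with p zero
  ... | true  = trans (cong (x +_) (sumᶠ-keepIf k (p ∘ suc) x))
                  (solve 2 (λ x c → x :+ c :* x := (con 1ℚ :+ c) :* x) refl x (toℚ (countᶠ k (p ∘ suc))))
  ... | false = trans (+-identityˡ _) (sumᶠ-keepIf k (p ∘ suc) x)

  sumᶠ-1 : ∀ k → sumᶠ k (λ _ → 1ℚ) ≡ toℚ k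
  sumᶠ-1 zero    = refl
  sumᶠ-1 (suc k) = cong (1ℚ +_) (sumᶠ-1 k)

  anyᶠ-cong : ∀ k {p q : Fin k → Bool} → (∀ i → p i ≡ q i) → anyᶠ k p ≡ anyᶠ k q
  anyᶠ-cong zero    e = refl
  anyᶠ-cong (suc k) e = cong₂ _∨_ (e zero) (anyᶠ-cong k (e ∘ suc))

  anyᶠ-false : ∀ k → anyᶠ k (λ _ → false) ≡ false
  anyᶠ-false zero    = refl
  anyᶠ-false (suc k) = anyᶠ-false k

  anyᶠ-+ : ∀ a b (p : Fin (a ℕ.+ b) → Bool) → anyᶠ (a ℕ.+ b) p ≡ anyᶠ a (p ∘ (_↑ˡ b)) ∨ anyᶠ b (p ∘ (a ↑ʳ_))
  anyᶠ-+ zero    b p = refl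
  anyᶠ-+ (suc a) b p = trans (cong (p zero ∨_) (anyᶠ-+ a b (p ∘ suc))) (sym (∨-assoc (p zero) _ _))

  anyᶠ≡false : ∀ k p → anyᶠ k p ≡ false → ∀ i → p i ≡ false
  anyᶠ≡false (suc k) p e i with p zero in eq
  anyᶠ≡false (suc k) p () i       | true
  anyᶠ≡false (suc k) p e zero    | false = eq
  anyᶠ≡false (suc k) p e (suc i) | false = anyᶠ≡false k (p ∘ suc) e i

  countᶠ-cong : ∀ k {p q : Fin k → Bool} → (∀ i → p i ≡ q i) → countᶠ k p ≡ countᶠ k q
  countᶠ-cong zero    e = refl
  countᶠ-cong (suc k) e = cong₂ (λ b c → (if b then 1 else 0) ℕ.+ c) (e zero) (countᶠ-cong k (e ∘ suc))

  countᶠ≤ : ∀ k p → countᶠ k p ℕ.≤ k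
  countᶠ≤ zero    p = z≤n
  countᶠ≤ (suc k) p with p zero
  ... | true  = s≤s (countᶠ≤ k (p ∘ suc))
  ... | false = ℕ.m≤n⇒m≤1+n (countᶠ≤ k (p ∘ suc))

  anyᶠ⇒1≤countᶠ : ∀ k p → anyᶠ k p ≡ true → 1 ℕ.≤ countᶠ k p
  anyᶠ⇒1≤countᶠ (suc k) p e with p zero
  ... | true  = s≤s z≤n
  ... | false = anyᶠ⇒1≤countᶠ k (p ∘ suc) e

  countᶠ-drop : ∀ k (p q : Fin k → Bool) i → p i ≡ true → q i ≡ false → (∀ j → ¬ j ≡ i → q j ≡ p j) →
    countᶠ k p ≡ suc (countᶠ k q)
  countᶠ-drop (suc k) p q zero pi qi e rewrite pi | qi =
    cong suc (countᶠ-cong k (λ j → sym (e (suc j) (λ ()))))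
  countᶠ-drop (suc k) p q (suc i) pi qi e rewrite e zero (λ ()) =
    trans (cong ((if p zero then 1 else 0) ℕ.+_)
                 (countᶠ-drop k (p ∘ suc) (q ∘ suc) i pi qi (λ j j≢i → e (suc j) (j≢i ∘ suc-injective))))
          (ℕ.+-suc (if p zero then 1 else 0) _)

  sumMap-++ : ∀ {A : Set} (g : A → ℚ) xs ys → sumMap g (xs ++ ys) ≡ sumMap g xs + sumMap g ys
  sumMap-++ g []       ys = sym (+-identityˡ _)
  sumMap-++ g (x ∷ xs) ys = trans (cong (g x +_) (sumMap-++ g xs ys)) (sym (+-assoc (g x) _ _))

  sumMap-concatMap : ∀ {A B : Set} (g : B → ℚ) (h : A → List B) xs →
    sumMap g (concatMap h xs) ≡ sumMap (sumMap g ∘ h) xs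
  sumMap-concatMap g h []       = refl
  sumMap-concatMap g h (x ∷ xs) = trans (sumMap-++ g (h x) (concatMap h xs)) (cong (sumMap g (h x) +_) (sumMap-concatMap g h xs))

  sumMap-*ˡ : ∀ {A : Set} (g : A → ℚ) k xs → sumMap (λ x → k * g x) xs ≡ k * sumMap g xs
  sumMap-*ˡ g k []       = sym (*-zeroʳ k)
  sumMap-*ˡ g k (x ∷ xs) = trans (cong (k * g x +_) (sumMap-*ˡ g k xs)) (sym (*-distribˡ-+ k (g x) (sumMap g xs)))

  sumMap-cong : ∀ {A : Set} {g h : A → ℚ} {xs} → All (λ x → g x ≡ h x) xs → sumMap g xs ≡ sumMap h xs
  sumMap-cong []       = refl
  sumMap-cong (e ∷ es) = cong₂ _+_ e (sumMap-cong es)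

  sumMap-mono-≤ : ∀ {A : Set} {g h : A → ℚ} {xs} → All (λ x → g x ≤ h x) xs → sumMap g xs ≤ sumMap h xs
  sumMap-mono-≤ []       = ≤-refl
  sumMap-mono-≤ (e ∷ es) = +-mono-≤ e (sumMap-mono-≤ es)

  sumMap-nonNeg : ∀ {A : Set} {g : A → ℚ} {xs} → All (λ x → 0ℚ ≤ g x) xs → 0ℚ ≤ sumMap g xs
  sumMap-nonNeg []       = ≤-refl
  sumMap-nonNeg (e ∷ es) = +-nonNeg e (sumMap-nonNeg es)

  sumMap-+ : ∀ {A : Set} (g h : A → ℚ) xs → sumMap (λ x → g x + h x) xs ≡ sumMap g xs + sumMap h xs
  sumMap-+ g h []       = sym (+-identityˡ 0ℚ)
  sumMap-+ g h (x ∷ xs) = trans (cong (g x + h x +_) (sumMap-+ g h xs))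
    (solve 4 (λ a b c d → (a :+ b) :+ (c :+ d) := (a :+ c) :+ (b :+ d)) refl (g x) (h x) (sumMap g xs) (sumMap h xs))

  sumMap-const : ∀ {A : Set} k (xs : List A) → sumMap (λ _ → k) xs ≡ toℚ (length xs) * k
  sumMap-const k []       = sym (*-zeroˡ k)
  sumMap-const k (x ∷ xs) = trans (cong (k +_) (sumMap-const k xs))
    (solve 2 (λ k l → k :+ l :* k := (con 1ℚ :+ l) :* k) refl k (toℚ (length xs)))

  filterᵇ-holds : ∀ {A : Set} (p : A → Bool) xs → All (λ x → p x ≡ true) (filterᵇ p xs)
  filterᵇ-holds p []       = []
  filterᵇ-holds p (x ∷ xs) with p x in eq
  ... | true  = eq ∷ filterᵇ-holds p xs
  ... | false = filterᵇ-holds p xs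

module Lyapunov where
  open import Data.Bool using (Bool; true; false; T; if_then_else_; not; _xor_; _∧_)
  open import Data.Bool.Properties using (T-≡; xor-same)
  open import Function.Bundles using (Equivalence)
  open import Data.Nat as ℕ using (ℕ; zero; suc)
  open import Data.Fin as Fin using (Fin)
  open import Data.Bool.ListAction using (and)
  open import Data.List using (List; []; _∷_; map; length; allFin; null)
  open import Data.List.Relation.Unary.All as All using (All; []; _∷_)
  open import Data.List.Relation.Unary.All.Properties using (concat⁺; map⁺; all⁻)
  open import Data.Product using (_×_; _,_; proj₁; proj₂)
  open import Data.Rational
  open import Data.Rational.Properties
  open import Data.Rational.Solver using (module +-*-Solver)
  open import Relation.Binary.PropositionalEquality
  open import Relation.Nullary using (¬_; yes; no; contradiction)
  open import Defs
  open RationalArithmetic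
  open FiniteSums

  open +-*-Solver

  toℚ-length*inv-length≡1 : ∀ {A : Set} (xs : List A) → not (null xs) ≡ true →
    toℚ (length xs) * inv (length xs) ≡ 1ℚ
  toℚ-length*inv-length≡1 (_ ∷ xs) _ = toℚ*inv≡1 (length xs)

  module DriftBound {m : ℕ} (adj : Fin m → Fin m → Bool) where
    open Voting adj

    Weighted : Set
    Weighted = List (Config m × ℚ)

    expect : (Config m → ℚ) → Weighted → ℚ
    expect Φ = sumMap (λ cp → proj₂ cp * Φ (proj₁ cp))

    NonNegWeights : Weighted → Set
    NonNegWeights = All (λ cp → 0ℚ ≤ proj₂ cp)

    unfinished : Config m → ℚ
    unfinished c = if mono c then 0ℚ else 1ℚ

    flip : Config m → Fin m → Config m
    flip c v = update c v (not (c v))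

    discordant : Config m → Fin m → Bool
    discordant c v = not (null (discNbrs c v))

    update-≡ : ∀ c v b → update c v b v ≡ b
    update-≡ c v b with v Fin.≟ v
    ... | yes _  = refl
    ... | no v≢v = contradiction refl v≢v

    update-≢ : ∀ c v b w → ¬ w ≡ v → update c v b w ≡ c w
    update-≢ c v b w w≢v with w Fin.≟ v
    ... | yes w≡v = contradiction w≡v w≢v
    ... | no _    = refl

    expect-scale : ∀ Φ p μ → expect Φ (map (λ cq → proj₁ cq , p * proj₂ cq) μ) ≡ p * expect Φ μ
    expect-scale Φ p []       = sym (*-zeroʳ p)
    expect-scale Φ p (x ∷ μ) = trans (cong (p * proj₂ x * Φ (proj₁ x) +_) (expect-scale Φ p μ))
      (solve 4 (λ p q r e → p :* q :* r :+ p :* e := p :* (q :* r :+ e)) refl p (proj₂ x) (Φ (proj₁ x)) (expect Φ μ))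

    expect-dist-suc : ∀ Φ t c → expect Φ (dist (suc t) c) ≡ sumMap (λ cp → proj₂ cp * expect Φ (step (proj₁ cp))) (dist t c)
    expect-dist-suc Φ t c = trans
      (sumMap-concatMap (λ cp → proj₂ cp * Φ (proj₁ cp))
                        (λ cp → map (λ cq → proj₁ cq , proj₂ cp * proj₂ cq) (step (proj₁ cp))) (dist t c))
      (sumMap-cong (All.universal (λ cp → expect-scale Φ (proj₂ cp) (step (proj₁ cp))) (dist t c)))

    nonNeg-step : ∀ c → NonNegWeights (step c)
    nonNeg-step c with discVerts c
    ... | []    = 0≤1 ∷ []
    ... | D@(_ ∷ _) = concat⁺ (map⁺ (All.universal (λ v → map⁺ (All.universal
                        (λ _ → *-nonNeg (inv-nonNeg (length D)) (inv-nonNeg (length (discNbrs c v)))) (discNbrs c v))) D))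

    nonNeg-dist : ∀ t c → NonNegWeights (dist t c)
    nonNeg-dist zero    c = 0≤1 ∷ []
    nonNeg-dist (suc t) c = concat⁺ (map⁺ (All.map (λ p≥0 → map⁺ (All.map (*-nonNeg p≥0) (nonNeg-step _))) (nonNeg-dist t c)))

    discVerts-discordant : ∀ c → All (λ v → discordant c v ≡ true) (discVerts c)
    discVerts-discordant c = filterᵇ-holds (discordant c) (allFin m)

    pull-from-discordant : ∀ c v u → (adj v u ∧ (c v xor c u)) ≡ true → update c v (c u) ≡ flip c v
    pull-from-discordant c v u h = cong (update c v) (xor≡true (c v) (c u) (∧-true h))
      where
      ∧-true : ∀ {a b} → (a ∧ b) ≡ true → b ≡ true
      ∧-true {true} e = e
      xor≡true : ∀ a b → (a xor b) ≡ true → b ≡ not a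
      xor≡true true  false _ = refl
      xor≡true false true  _ = refl

    module _ (Φ : Config m → ℚ) where

      expect-pulls : ∀ c v w N → All (λ u → (adj v u ∧ (c v xor c u)) ≡ true) N →
        expect Φ (map (λ u → update c v (c u) , w) N) ≡ toℚ (length N) * (w * Φ (flip c v))
      expect-pulls c v w []       []       = sym (*-zeroˡ (w * Φ (flip c v)))
      expect-pulls c v w (u ∷ N) (h ∷ hs) =
        trans (cong₂ (λ c′ e → w * Φ c′ + e) (pull-from-discordant c v u h) (expect-pulls c v w N hs))
          (solve 3 (λ w F l → w :* F :+ l :* (w :* F) := (con 1ℚ :+ l) :* (w :* F)) refl w (Φ (flip c v)) (toℚ (length N)))

      expect-stepWith : ∀ c v vs → let D = v ∷ vs in All (λ v → discordant c v ≡ true) D →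
        expect Φ (stepWith c D) ≡ inv (length D) * sumMap (λ v → Φ (flip c v)) D
      expect-stepWith c v vs hD = begin
        expect Φ (stepWith c D)
          ≡⟨ sumMap-concatMap (λ cp → proj₂ cp * Φ (proj₁ cp)) pulls D ⟩
        sumMap (λ v → expect Φ (pulls v)) D
          ≡⟨ sumMap-cong (All.map (λ {v} → per-vertex v) hD) ⟩
        sumMap (λ v → inv (length D) * Φ (flip c v)) D
          ≡⟨ sumMap-*ˡ (λ v → Φ (flip c v)) (inv (length D)) D ⟩
        inv (length D) * sumMap (λ v → Φ (flip c v)) D ∎
        where
        open ≡-Reasoning
        D : List (Fin m)
        D = v ∷ vs
        pulls : Fin m → Weighted
        pulls v = map (λ u → update c v (c u) , inv (length D) * inv (length (discNbrs c v))) (discNbrs c v)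
        per-vertex : ∀ v → discordant c v ≡ true → expect Φ (pulls v) ≡ inv (length D) * Φ (flip c v)
        per-vertex v hv = trans (expect-pulls c v (i * j) N (filterᵇ-holds _ (allFin m))) (begin
          toℚ (length N) * ((i * j) * F)  ≡⟨ solve 4 (λ l i j F → l :* ((i :* j) :* F) := (l :* j) :* (i :* F)) refl (toℚ (length N)) i j F ⟩
          (toℚ (length N) * j) * (i * F)  ≡⟨ cong (_* (i * F)) (toℚ-length*inv-length≡1 N hv) ⟩
          1ℚ * (i * F)                    ≡⟨ *-identityˡ (i * F) ⟩
          i * F                           ∎)
          where
          N : List (Fin m)
          N = discNbrs c v
          i j F : ℚ
          i = inv (length D)
          j = inv (length N)
          F = Φ (flip c v)

      unfinished≤1 : ∀ c → unfinished c ≤ 1ℚ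
      unfinished≤1 c with mono c
      ... | true  = 0≤1
      ... | false = ≤-refl

      drift-stepWith : ∀ c D → All (λ v → discordant c v ≡ true) D → (D ≡ [] → mono c ≡ true) →
        sumMap (λ v → Φ (flip c v) - Φ c + 1ℚ) D ≤ 0ℚ → expect Φ (stepWith c D) + unfinished c ≤ Φ c
      drift-stepWith c [] _ D≡[]⇒mono _ rewrite D≡[]⇒mono refl =
        ≤-reflexive (solve 1 (λ x → con 1ℚ :* x :+ con 0ℚ :+ con 0ℚ := x) refl (Φ c))
      drift-stepWith c D@(v ∷ vs) hD _ S≤0 = begin
        expect Φ (stepWith c D) + unfinished c               ≤⟨ +-monoʳ-≤ (expect Φ (stepWith c D)) (unfinished≤1 c) ⟩
        expect Φ (stepWith c D) + 1ℚ                          ≡⟨ cong (_+ 1ℚ) (expect-stepWith c v vs hD) ⟩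
        inv (length D) * sumMap (λ v → Φ (flip c v)) D + 1ℚ  ≡⟨ cong (λ z → inv (length D) * z + 1ℚ) flips≡ ⟩
        inv (length D) * (S + toℚ (length D) * (Φ c - 1ℚ)) + 1ℚ
          ≡⟨ solve 5 (λ i s l F o → i :* (s :+ l :* (F :- o)) :+ o := i :* s :+ (l :* i) :* (F :- o) :+ o) refl
               (inv (length D)) S (toℚ (length D)) (Φ c) 1ℚ ⟩
        inv (length D) * S + (toℚ (length D) * inv (length D)) * (Φ c - 1ℚ) + 1ℚ
          ≡⟨ cong (λ z → inv (length D) * S + z * (Φ c - 1ℚ) + 1ℚ) (toℚ*inv≡1 (length vs)) ⟩
        inv (length D) * S + 1ℚ * (Φ c - 1ℚ) + 1ℚ            ≤⟨ +-monoˡ-≤ 1ℚ (+-monoˡ-≤ (1ℚ * (Φ c - 1ℚ)) iS≤0) ⟩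
        0ℚ + 1ℚ * (Φ c - 1ℚ) + 1ℚ                             ≡⟨ solve 1 (λ F → con 0ℚ :+ con 1ℚ :* (F :- con 1ℚ) :+ con 1ℚ := F) refl (Φ c) ⟩
        Φ c                                                   ∎
        where
        open ≤-Reasoning
        S : ℚ
        S = sumMap (λ v → Φ (flip c v) - Φ c + 1ℚ) D
        flips≡ : sumMap (λ v → Φ (flip c v)) D ≡ S + toℚ (length D) * (Φ c - 1ℚ)
        flips≡ = trans (sumMap-cong (All.universal (λ v → solve 2 (λ x F → x := (x :- F :+ con 1ℚ) :+ (F :- con 1ℚ)) refl (Φ (flip c v)) (Φ c)) D))
                       (trans (sumMap-+ (λ v → Φ (flip c v) - Φ c + 1ℚ) (λ _ → Φ c - 1ℚ) D)
                              (cong (S +_) (sumMap-const (Φ c - 1ℚ) D)))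
        iS≤0 : inv (length D) * S ≤ 0ℚ
        iS≤0 = subst (inv (length D) * S ≤_) (*-zeroʳ (inv (length D)))
                 (*-monoˡ-≤-nonNeg (inv (length D)) {{nonNegative (inv-nonNeg (length D))}} S≤0)

      drift-from-flips : ∀ c → (discVerts c ≡ [] → mono c ≡ true) →
        sumMap (λ v → Φ (flip c v) - Φ c + 1ℚ) (discVerts c) ≤ 0ℚ → expect Φ (step c) + unfinished c ≤ Φ c
      drift-from-flips c = drift-stepWith c (discVerts c) (discVerts-discordant c)

    -- Φ is a Lyapunov function: partialET t + 𝔼 Φ(X_t) is non-increasing in t.
    module _ (Φ : Config m → ℚ) (Φ-nonNeg : ∀ c → 0ℚ ≤ Φ c)
             (Φ-drift : ∀ c → expect Φ (step c) + unfinished c ≤ Φ c) where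

      *-unfinished : ∀ p c → p * unfinished c ≡ (if mono c then 0ℚ else p)
      *-unfinished p c with mono c
      ... | true  = *-zeroʳ p
      ... | false = *-identityʳ p

      weighted-drift : ∀ cp → 0ℚ ≤ proj₂ cp →
        proj₂ cp * expect Φ (step (proj₁ cp)) + (if mono (proj₁ cp) then 0ℚ else proj₂ cp) ≤ proj₂ cp * Φ (proj₁ cp)
      weighted-drift (c , p) p≥0 =
        subst (_≤ p * Φ c) (trans (*-distribˡ-+ p (expect Φ (step c)) (unfinished c)) (cong (p * expect Φ (step c) +_) (*-unfinished p c)))
          (*-monoˡ-≤-nonNeg p {{nonNegative p≥0}} (Φ-drift c))

      partialET+expect≤Φ : ∀ t c → partialET t c + expect Φ (dist t c) ≤ Φ c
      partialET+expect≤Φ zero    c = ≤-reflexive (solve 1 (λ x → con 0ℚ :+ (con 1ℚ :* x :+ con 0ℚ) := x) refl (Φ c))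
      partialET+expect≤Φ (suc t) c = begin
        partialET t c + tailProb t c + expect Φ (dist (suc t) c)
          ≡⟨ cong (partialET t c + tailProb t c +_) (expect-dist-suc Φ t c) ⟩
        partialET t c + tailProb t c + sumMap (λ cp → proj₂ cp * expect Φ (step (proj₁ cp))) (dist t c)
          ≡⟨ +-assoc (partialET t c) (tailProb t c) _ ⟩
        partialET t c + (tailProb t c + sumMap (λ cp → proj₂ cp * expect Φ (step (proj₁ cp))) (dist t c))
          ≡⟨ cong (partialET t c +_) (trans (+-comm (tailProb t c) _) (sym (sumMap-+ next weightIfUnfinished (dist t c)))) ⟩
        partialET t c + sumMap (λ cp → next cp + weightIfUnfinished cp) (dist t c)
          ≤⟨ +-monoʳ-≤ (partialET t c) (sumMap-mono-≤ (All.map (λ {cp} → weighted-drift cp) (nonNeg-dist t c))) ⟩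
        partialET t c + expect Φ (dist t c)
          ≤⟨ partialET+expect≤Φ t c ⟩
        Φ c ∎
        where
        open ≤-Reasoning
        next weightIfUnfinished : Config m × ℚ → ℚ
        next               cp = proj₂ cp * expect Φ (step (proj₁ cp))
        weightIfUnfinished cp = if mono (proj₁ cp) then 0ℚ else proj₂ cp

      partialET≤Φ : ∀ t c → partialET t c ≤ Φ c
      partialET≤Φ t c = ≤-trans
        (≤-by-slack (expect Φ (dist t c)) (sumMap-nonNeg (All.map (λ {cp} p≥0 → *-nonNeg p≥0 (Φ-nonNeg (proj₁ cp))) (nonNeg-dist t c))) refl)
        (partialET+expect≤Φ t c)

    constant⇒mono : ∀ c x → (∀ v → c v ≡ x) → mono c ≡ true
    constant⇒mono c x c≡x = Equivalence.to T-≡ (all⁻ agreesWithAll (All.universal (λ u → all⁻ (agrees u) (All.universal (λ v →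
      subst T (sym (trans (cong₂ (λ a b → not (a xor b)) (c≡x u) (c≡x v)) (cong not (xor-same x)))) _) (allFin m))) (allFin m)))
      where
      agrees : Fin m → Fin m → Bool
      agrees u v = not (c u xor c v)
      agreesWithAll : Fin m → Bool
      agreesWithAll u = and (map (agrees u) (allFin m))

module DoubleStarVoting where
  open import Data.Bool using (Bool; true; false; if_then_else_; _∨_; _∧_; not; _xor_)
  open import Data.Bool.Properties using (T-≡; ∨-identityʳ; xor-comm; not-distribˡ-xor; not-distribʳ-xor)
  open import Data.Nat as ℕ using (ℕ; zero; suc; _<ᵇ_; s≤s)
  import Data.Nat.Properties as ℕ
  open import Data.Fin using (Fin; zero; suc; toℕ; _↑ˡ_; _↑ʳ_; splitAt)
  open import Data.Fin.Properties using (toℕ-↑ˡ; toℕ-↑ʳ; toℕ<n; ↑ˡ-injective; ↑ʳ-injective; suc-injective;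
    splitAt-↑ˡ; splitAt-↑ʳ; splitAt⁻¹-↑ˡ; splitAt⁻¹-↑ʳ)
  open import Data.List using ([])
  open import Data.Product using (_×_; _,_; proj₁; proj₂)
  open import Data.Sum using (inj₁; inj₂)
  open import Data.Rational using (ℚ; 0ℚ; 1ℚ; _+_; _-_; _*_; _≤_)
  open import Data.Rational.Properties using (≤-refl; ≤-trans)
  open import Data.Rational.Solver using (module +-*-Solver)
  open import Function using (_∘_)
  open import Function.Bundles using (Equivalence)
  open import Relation.Binary.PropositionalEquality
  open import Relation.Nullary using (¬_; contradiction)
  open import Defs
  open RationalArithmetic
  open FiniteSums
  open Lyapunov

  open +-*-Solver

  <⇒<ᵇ≡true : ∀ {m n} → m ℕ.< n → (m <ᵇ n) ≡ true
  <⇒<ᵇ≡true m<n = Equivalence.to T-≡ (ℕ.<⇒<ᵇ m<n)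

  ≮⇒<ᵇ≡false : ∀ {m n} → ¬ m ℕ.< n → (m <ᵇ n) ≡ false
  ≮⇒<ᵇ≡false {m} {n} m≮n with m <ᵇ n in eq
  ... | true  = contradiction (ℕ.<ᵇ⇒< m n (Equivalence.from T-≡ eq)) m≮n
  ... | false = refl

  ∨≡false : ∀ a b → (a ∨ b) ≡ false → a ≡ false × b ≡ false
  ∨≡false false false _ = refl , refl

  xor≡false⇒≡ : ∀ a b → (a xor b) ≡ false → b ≡ a
  xor≡false⇒≡ true  true  _ = refl
  xor≡false⇒≡ false false _ = refl

  not-xor : ∀ a b {d} → (a xor b) ≡ d → (not a xor b) ≡ not d
  not-xor a b e = trans (sym (not-distribˡ-xor a b)) (cong not e)

  xor-not : ∀ a b {d} → (a xor b) ≡ d → (a xor not b) ≡ not d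
  xor-not a b e = trans (sym (not-distribʳ-xor a b)) (cong not e)

  keepIf-1≤1 : ∀ d → keepIf d 1ℚ ≤ 1ℚ
  keepIf-1≤1 true  = ≤-refl
  keepIf-1≤1 false = 0≤1

  module DoubleStarChain (n : ℕ) where
    open Voting (doubleStar n)
    open DriftBound (doubleStar n)

    Vertex : Set
    Vertex = Fin (suc (suc (n ℕ.+ n)))

    adj : Vertex → Vertex → Bool
    adj = doubleStar n

    centre₀ centre₁ : Vertex
    centre₀ = zero
    centre₁ = suc zero

    leaf₀ leaf₁ : Fin n → Vertex
    leaf₀ i = suc (suc (i ↑ˡ n))
    leaf₁ j = suc (suc (n ↑ʳ j))

    leaf₀-injective : ∀ {i j} → leaf₀ j ≡ leaf₀ i → j ≡ i
    leaf₀-injective = ↑ˡ-injective n _ _ ∘ suc-injective ∘ suc-injective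

    leaf₁-injective : ∀ {i j} → leaf₁ j ≡ leaf₁ i → j ≡ i
    leaf₁-injective = ↑ʳ-injective n _ _ ∘ suc-injective ∘ suc-injective

    leaf₁≢leaf₀ : ∀ i j → ¬ leaf₁ j ≡ leaf₀ i
    leaf₁≢leaf₀ i j e with () ← trans (sym (splitAt-↑ʳ n n j))
      (trans (cong (splitAt n) (suc-injective (suc-injective e))) (splitAt-↑ˡ n i n))

    private
      i<n : ∀ (i : Fin n) → (toℕ i <ᵇ n) ≡ true
      i<n i = <⇒<ᵇ≡true (toℕ<n i)
      n+j≮n : ∀ (j : Fin n) → (n ℕ.+ toℕ j <ᵇ n) ≡ false
      n+j≮n j = ≮⇒<ᵇ≡false (ℕ.m+n≮m n (toℕ j))
      n≮1+i : ∀ (i : Fin n) → (n <ᵇ suc (toℕ i)) ≡ false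
      n≮1+i i = ≮⇒<ᵇ≡false (ℕ.<⇒≱ (toℕ<n i) ∘ ℕ.s≤s⁻¹)
      n<1+n+j : ∀ (j : Fin n) → (n <ᵇ suc (n ℕ.+ toℕ j)) ≡ true
      n<1+n+j j = <⇒<ᵇ≡true (s≤s (ℕ.m≤m+n n (toℕ j)))

    adj-centre₀-leaf₀ : ∀ i → adj centre₀ (leaf₀ i) ≡ true
    adj-centre₀-leaf₀ i rewrite toℕ-↑ˡ i n | i<n i = refl
    adj-centre₀-leaf₁ : ∀ j → adj centre₀ (leaf₁ j) ≡ false
    adj-centre₀-leaf₁ j rewrite toℕ-↑ʳ n j | n+j≮n j = refl
    adj-centre₁-leaf₀ : ∀ i → adj centre₁ (leaf₀ i) ≡ false
    adj-centre₁-leaf₀ i rewrite toℕ-↑ˡ i n | n≮1+i i = refl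
    adj-centre₁-leaf₁ : ∀ j → adj centre₁ (leaf₁ j) ≡ true
    adj-centre₁-leaf₁ j rewrite toℕ-↑ʳ n j | n<1+n+j j = refl
    adj-leaf₀-centre₀ : ∀ i → adj (leaf₀ i) centre₀ ≡ true
    adj-leaf₀-centre₀ i rewrite toℕ-↑ˡ i n | i<n i = refl
    adj-leaf₀-centre₁ : ∀ i → adj (leaf₀ i) centre₁ ≡ false
    adj-leaf₀-centre₁ i rewrite toℕ-↑ˡ i n | n≮1+i i = refl
    adj-leaf₁-centre₀ : ∀ j → adj (leaf₁ j) centre₀ ≡ false
    adj-leaf₁-centre₀ j rewrite toℕ-↑ʳ n j | n+j≮n j = refl
    adj-leaf₁-centre₁ : ∀ j → adj (leaf₁ j) centre₁ ≡ true
    adj-leaf₁-centre₁ j rewrite toℕ-↑ʳ n j | n<1+n+j j = refl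

    Colouring : Set
    Colouring = Config (suc (suc (n ℕ.+ n)))

    isStray₀ isStray₁ : Colouring → Fin n → Bool
    isStray₀ c i = c (leaf₀ i) xor c centre₀
    isStray₁ c j = c (leaf₁ j) xor c centre₁

    strays₀ strays₁ : Colouring → ℕ
    strays₀ c = countᶠ n (isStray₀ c)
    strays₁ c = countᶠ n (isStray₁ c)

    discordant≡any : ∀ c v → discordant c v ≡ anyᶠ _ (λ u → adj v u ∧ (c v xor c u))
    discordant≡any c v = nonNull-filter-tabulate _ (λ u → u) (λ u → adj v u ∧ (c v xor c u))

    discordant-centre₀ : ∀ c → discordant c centre₀ ≡ (c centre₀ xor c centre₁) ∨ anyᶠ n (isStray₀ c)
    discordant-centre₀ c = trans (discordant≡any c centre₀) (cong ((c centre₀ xor c centre₁) ∨_)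
      (trans (anyᶠ-+ n n _) (trans (cong₂ _∨_
          (anyᶠ-cong n (λ i → cong₂ _∧_ (adj-centre₀-leaf₀ i) (xor-comm (c centre₀) (c (leaf₀ i)))))
          (trans (anyᶠ-cong n (λ j → cong (_∧ (c centre₀ xor c (leaf₁ j))) (adj-centre₀-leaf₁ j))) (anyᶠ-false n)))
        (∨-identityʳ _))))

    discordant-centre₁ : ∀ c → discordant c centre₁ ≡ (c centre₀ xor c centre₁) ∨ anyᶠ n (isStray₁ c)
    discordant-centre₁ c = trans (discordant≡any c centre₁) (cong₂ _∨_ (xor-comm (c centre₁) (c centre₀))
      (trans (anyᶠ-+ n n _) (cong₂ _∨_
          (trans (anyᶠ-cong n (λ i → cong (_∧ (c centre₁ xor c (leaf₀ i))) (adj-centre₁-leaf₀ i))) (anyᶠ-false n))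
          (anyᶠ-cong n (λ j → cong₂ _∧_ (adj-centre₁-leaf₁ j) (xor-comm (c centre₁) (c (leaf₁ j))))))))

    -- Two leaves are never adjacent, which Agda sees by computation.
    discordant-leaf : ∀ c w → let v = suc (suc w) in
      discordant c v ≡ (adj v centre₀ ∧ (c v xor c centre₀)) ∨ (adj v centre₁ ∧ (c v xor c centre₁))
    discordant-leaf c w = trans (discordant≡any c v) (cong (x₀ ∨_) (trans (cong (x₁ ∨_) (anyᶠ-false (n ℕ.+ n))) (∨-identityʳ x₁)))
      where
      v : Vertex
      v = suc (suc w)
      x₀ x₁ : Bool
      x₀ = adj v centre₀ ∧ (c v xor c centre₀)
      x₁ = adj v centre₁ ∧ (c v xor c centre₁)

    discordant-leaf₀ : ∀ c i → discordant c (leaf₀ i) ≡ (c (leaf₀ i) xor c centre₀)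
    discordant-leaf₀ c i = trans (discordant-leaf c (i ↑ˡ n))
      (trans (cong₂ (λ a b → (a ∧ (c (leaf₀ i) xor c centre₀)) ∨ (b ∧ (c (leaf₀ i) xor c centre₁)))
                    (adj-leaf₀-centre₀ i) (adj-leaf₀-centre₁ i))
             (∨-identityʳ (c (leaf₀ i) xor c centre₀)))

    discordant-leaf₁ : ∀ c j → discordant c (leaf₁ j) ≡ (c (leaf₁ j) xor c centre₁)
    discordant-leaf₁ c j = trans (discordant-leaf c (n ↑ʳ j))
      (cong₂ (λ a b → (a ∧ (c (leaf₁ j) xor c centre₀)) ∨ (b ∧ (c (leaf₁ j) xor c centre₁)))
             (adj-leaf₁-centre₀ j) (adj-leaf₁-centre₁ j))

    Φ : Colouring → ℚ
    Φ c = if c centre₀ xor c centre₁ then K n else agreePotential n (strays₀ c) (strays₁ c)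

    Φ-disagree : ∀ c → (c centre₀ xor c centre₁) ≡ true → Φ c ≡ K n
    Φ-disagree c e rewrite e = refl

    Φ-agree : ∀ c → (c centre₀ xor c centre₁) ≡ false → Φ c ≡ agreePotential n (strays₀ c) (strays₁ c)
    Φ-agree c e rewrite e = refl

    strays₀-flip-leaf₀ : ∀ c i → (c (leaf₀ i) xor c centre₀) ≡ true → strays₀ c ≡ suc (strays₀ (flip c (leaf₀ i)))
    strays₀-flip-leaf₀ c i h = countᶠ-drop n _ _ i h
      (trans (cong (_xor c centre₀) (update-≡ c (leaf₀ i) (not (c (leaf₀ i))))) (not-xor (c (leaf₀ i)) (c centre₀) h))
      (λ j j≢i → cong (_xor c centre₀) (update-≢ c (leaf₀ i) _ (leaf₀ j) (j≢i ∘ leaf₀-injective)))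

    strays₁-flip-leaf₁ : ∀ c j → (c (leaf₁ j) xor c centre₁) ≡ true → strays₁ c ≡ suc (strays₁ (flip c (leaf₁ j)))
    strays₁-flip-leaf₁ c j h = countᶠ-drop n _ _ j h
      (trans (cong (_xor c centre₁) (update-≡ c (leaf₁ j) (not (c (leaf₁ j))))) (not-xor (c (leaf₁ j)) (c centre₁) h))
      (λ i i≢j → cong (_xor c centre₁) (update-≢ c (leaf₁ j) _ (leaf₁ i) (i≢j ∘ leaf₁-injective)))

    strays₁-flip-leaf₀ : ∀ c i → strays₁ (flip c (leaf₀ i)) ≡ strays₁ c
    strays₁-flip-leaf₀ c i = countᶠ-cong n (λ j → cong (_xor c centre₁) (update-≢ c (leaf₀ i) _ (leaf₁ j) (leaf₁≢leaf₀ i j)))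

    strays₀-flip-leaf₁ : ∀ c j → strays₀ (flip c (leaf₁ j)) ≡ strays₀ c
    strays₀-flip-leaf₁ c j = countᶠ-cong n (λ i → cong (_xor c centre₀) (update-≢ c (leaf₁ j) _ (leaf₀ i) (leaf₁≢leaf₀ i j ∘ sym)))

    flipDrift : Colouring → Vertex → ℚ
    flipDrift c v = Φ (flip c v) - Φ c + 1ℚ

    keepDiscordant : Colouring → Vertex → ℚ
    keepDiscordant c v = keepIf (discordant c v) (flipDrift c v)

    sum-flipDrift-split : ∀ c → sumMap (flipDrift c) (discVerts c) ≡
      keepDiscordant c centre₀ + (keepDiscordant c centre₁
        + (sumᶠ n (keepDiscordant c ∘ leaf₀) + sumᶠ n (keepDiscordant c ∘ leaf₁)))
    sum-flipDrift-split c = trans (sumMap-filter-tabulate _ (λ u → u) (discordant c) (flipDrift c))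
      (cong (λ z → keepDiscordant c centre₀ + (keepDiscordant c centre₁ + z))
            (sumᶠ-+ n n (λ w → keepDiscordant c (suc (suc w)))))

    sum-flipDrift≤0-agree : ∀ c → (c centre₀ xor c centre₁) ≡ false → sumMap (flipDrift c) (discVerts c) ≤ 0ℚ
    sum-flipDrift≤0-agree c agree = subst (_≤ 0ℚ) (sym (trans (sum-flipDrift-split c) regroup))
      (agree-drift n a b (discordant c centre₀) (discordant c centre₁) a≥1 b≥1)
      where
      a b : ℕ
      a = strays₀ c
      b = strays₁ c
      a≥1 : discordant c centre₀ ≡ true → 1 ℕ.≤ a
      a≥1 e = anyᶠ⇒1≤countᶠ n (isStray₀ c) (subst (λ d → d ∨ anyᶠ n (isStray₀ c) ≡ true) agree (trans (sym (discordant-centre₀ c)) e))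
      b≥1 : discordant c centre₁ ≡ true → 1 ℕ.≤ b
      b≥1 e = anyᶠ⇒1≤countᶠ n (isStray₁ c) (subst (λ d → d ∨ anyᶠ n (isStray₁ c) ≡ true) agree (trans (sym (discordant-centre₁ c)) e))
      Φc : Φ c ≡ agreePotential n a b
      Φc = Φ-agree c agree
      T₀ T₁ : ℚ
      T₀ = agreePotential n (a ℕ.∸ 1) b - agreePotential n a b + 1ℚ
      T₁ = agreePotential n a (b ℕ.∸ 1) - agreePotential n a b + 1ℚ
      leaf₀-term : ∀ i → keepDiscordant c (leaf₀ i) ≡ keepIf (c (leaf₀ i) xor c centre₀) T₀
      leaf₀-term i rewrite discordant-leaf₀ c i with c (leaf₀ i) xor c centre₀ in stray
      ... | false = refl
      ... | true  = cong₂ (λ u w → u - w + 1ℚ)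
        (trans (Φ-agree (flip c (leaf₀ i)) agree)
               (cong₂ (agreePotential n) (cong ℕ.pred (sym (strays₀-flip-leaf₀ c i stray))) (strays₁-flip-leaf₀ c i))) Φc
      leaf₁-term : ∀ j → keepDiscordant c (leaf₁ j) ≡ keepIf (c (leaf₁ j) xor c centre₁) T₁
      leaf₁-term j rewrite discordant-leaf₁ c j with c (leaf₁ j) xor c centre₁ in stray
      ... | false = refl
      ... | true  = cong₂ (λ u w → u - w + 1ℚ)
        (trans (Φ-agree (flip c (leaf₁ j)) agree)
               (cong₂ (agreePotential n) (strays₀-flip-leaf₁ c j) (cong ℕ.pred (sym (strays₁-flip-leaf₁ c j stray))))) Φc
      regroup : keepDiscordant c centre₀ + (keepDiscordant c centre₁
                  + (sumᶠ n (keepDiscordant c ∘ leaf₀) + sumᶠ n (keepDiscordant c ∘ leaf₁)))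
                ≡ keepIf (discordant c centre₀) (K n - agreePotential n a b + 1ℚ)
                  + (keepIf (discordant c centre₁) (K n - agreePotential n a b + 1ℚ) + (toℚ a * T₀ + toℚ b * T₁))
      regroup = cong₂ _+_
        (cong (keepIf (discordant c centre₀)) (cong₂ (λ u w → u - w + 1ℚ)
          (Φ-disagree (flip c centre₀) (not-xor (c centre₀) (c centre₁) agree)) Φc))
        (cong₂ _+_
          (cong (keepIf (discordant c centre₁)) (cong₂ (λ u w → u - w + 1ℚ)
            (Φ-disagree (flip c centre₁) (xor-not (c centre₀) (c centre₁) agree)) Φc))
          (cong₂ _+_ (trans (sumᶠ-cong n leaf₀-term) (sumᶠ-keepIf n _ T₀))
                     (trans (sumᶠ-cong n leaf₁-term) (sumᶠ-keepIf n _ T₁))))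

    sum-flipDrift≤0-disagree : ∀ c → (c centre₀ xor c centre₁) ≡ true → sumMap (flipDrift c) (discVerts c) ≤ 0ℚ
    sum-flipDrift≤0-disagree c disagree = subst (_≤ 0ℚ) (sym (trans (sum-flipDrift-split c) regroup))
      (disagree-drift n u₀ u₁ s₀ s₁ (u≤ (flip c centre₀)) (u≤ (flip c centre₁)) (leaves≤n (_↑ˡ n)) (leaves≤n (n ↑ʳ_)))
      where
      u₀ u₁ s₀ s₁ : ℚ
      u₀ = agreePotential n (strays₀ (flip c centre₀)) (strays₁ (flip c centre₀))
      u₁ = agreePotential n (strays₀ (flip c centre₁)) (strays₁ (flip c centre₁))
      s₀ = sumᶠ n (keepDiscordant c ∘ leaf₀)
      s₁ = sumᶠ n (keepDiscordant c ∘ leaf₁)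
      u≤ : ∀ c′ → agreePotential n (strays₀ c′) (strays₁ c′) ≤ K n - toℚ 8 * toℚ (suc n) + toℚ 2 * (toℚ n + toℚ n)
      u≤ c′ = agreePotential≤K-8[n+1] n _ _ (countᶠ≤ n (isStray₀ c′)) (countᶠ≤ n (isStray₁ c′))
      Φc : Φ c ≡ K n
      Φc = Φ-disagree c disagree
      -- Flipping a leaf leaves the centres disagreeing, so Φ stays at K.
      leaves≤n : (w : Fin n → Fin (n ℕ.+ n)) → sumᶠ n (λ i → keepDiscordant c (suc (suc (w i)))) ≤ toℚ n
      leaves≤n w = subst (sumᶠ n (λ i → keepDiscordant c (suc (suc (w i)))) ≤_) (sumᶠ-1 n) (sumᶠ-mono-≤ n λ i →
        subst (λ z → keepIf (discordant c (suc (suc (w i)))) z ≤ 1ℚ)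
          (sym (trans (cong₂ (λ u v → u - v + 1ℚ) (Φ-disagree (flip c (suc (suc (w i)))) disagree) Φc)
                      (solve 1 (λ k → k :- k :+ con 1ℚ := con 1ℚ) refl (K n))))
          (keepIf-1≤1 (discordant c (suc (suc (w i))))))
      regroup : keepDiscordant c centre₀ + (keepDiscordant c centre₁ + (s₀ + s₁))
                ≡ (u₀ - K n + 1ℚ) + ((u₁ - K n + 1ℚ) + (s₀ + s₁))
      regroup = cong₂ _+_
        (trans (cong (λ d → keepIf d (flipDrift c centre₀)) d₀)
               (cong₂ (λ u w → u - w + 1ℚ) (Φ-agree (flip c centre₀) (not-xor (c centre₀) (c centre₁) disagree)) Φc))
        (cong (_+ (s₀ + s₁)) (trans (cong (λ d → keepIf d (flipDrift c centre₁)) d₁)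
               (cong₂ (λ u w → u - w + 1ℚ) (Φ-agree (flip c centre₁) (xor-not (c centre₀) (c centre₁) disagree)) Φc)))
        where
        d₀ : discordant c centre₀ ≡ true
        d₀ = trans (discordant-centre₀ c) (cong (_∨ anyᶠ n (isStray₀ c)) disagree)
        d₁ : discordant c centre₁ ≡ true
        d₁ = trans (discordant-centre₁ c) (cong (_∨ anyᶠ n (isStray₁ c)) disagree)

    no-discordant⇒mono : ∀ c → discVerts c ≡ [] → mono c ≡ true
    no-discordant⇒mono c noDisc = constant⇒mono c (c centre₀) colour≡
      where
      quiet : ∀ v → discordant c v ≡ false
      quiet = filter-tabulate≡[] _ (λ u → u) (discordant c) noDisc
      quiet₀ : (c centre₀ xor c centre₁) ≡ false × anyᶠ n (isStray₀ c) ≡ false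
      quiet₀ = ∨≡false _ _ (trans (sym (discordant-centre₀ c)) (quiet centre₀))
      quiet₁ : (c centre₀ xor c centre₁) ≡ false × anyᶠ n (isStray₁ c) ≡ false
      quiet₁ = ∨≡false _ _ (trans (sym (discordant-centre₁ c)) (quiet centre₁))
      centre₁≡ : c centre₁ ≡ c centre₀
      centre₁≡ = xor≡false⇒≡ (c centre₀) (c centre₁) (proj₁ quiet₀)
      leaf₀≡ : ∀ i → c (leaf₀ i) ≡ c centre₀
      leaf₀≡ i = sym (xor≡false⇒≡ _ _ (anyᶠ≡false n (isStray₀ c) (proj₂ quiet₀) i))
      leaf₁≡ : ∀ j → c (leaf₁ j) ≡ c centre₀
      leaf₁≡ j = trans (sym (xor≡false⇒≡ _ _ (anyᶠ≡false n (isStray₁ c) (proj₂ quiet₁) j))) centre₁≡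
      colour≡ : ∀ v → c v ≡ c centre₀
      colour≡ zero          = refl
      colour≡ (suc zero)    = centre₁≡
      colour≡ (suc (suc w)) with splitAt n w in eq
      ... | inj₁ i = subst (λ u → c (suc (suc u)) ≡ c centre₀) (splitAt⁻¹-↑ˡ eq) (leaf₀≡ i)
      ... | inj₂ j = subst (λ u → c (suc (suc u)) ≡ c centre₀) (splitAt⁻¹-↑ʳ eq) (leaf₁≡ j)

    Φ-drift : ∀ c → expect Φ (step c) + unfinished c ≤ Φ c
    Φ-drift c = drift-from-flips Φ c (no-discordant⇒mono c) (by-centres (c centre₀ xor c centre₁) refl)
      where
      by-centres : ∀ d → (c centre₀ xor c centre₁) ≡ d → sumMap (flipDrift c) (discVerts c) ≤ 0ℚ
      by-centres true  = sum-flipDrift≤0-disagree c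
      by-centres false = sum-flipDrift≤0-agree c

    Φ-nonNeg : ∀ c → 0ℚ ≤ Φ c
    Φ-nonNeg c with c centre₀ xor c centre₁
    ... | true  = K-nonNeg n
    ... | false = agreePotential-nonNeg n (strays₀ c) (strays₁ c)

    Φ≤K+4n : ∀ c → Φ c ≤ K n + toℚ 2 * (toℚ n + toℚ n)
    Φ≤K+4n c with c centre₀ xor c centre₁
    ... | true  = ≤-by-slack (toℚ 2 * (toℚ n + toℚ n)) (*-nonNeg (toℚ-nonNeg 2) (+-nonNeg (toℚ-nonNeg n) (toℚ-nonNeg n))) refl
    ... | false = agreePotential≤ n (strays₀ c) (strays₁ c) (countᶠ≤ n (isStray₀ c)) (countᶠ≤ n (isStray₁ c))

    partialET≤K+4n : ∀ t c → partialET t c ≤ K n + toℚ 2 * (toℚ n + toℚ n)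
    partialET≤K+4n t c = ≤-trans (partialET≤Φ Φ Φ-nonNeg Φ-drift t c) (Φ≤K+4n c)

open import Defs
open import Data.Nat using (ℕ; suc; _+_; _*_; _^_; _≤_; s≤s; z≤n)
open import Data.Integer using (+_)
open import Data.Product using (∃-syntax; _,_)
open import Data.Rational using (ℚ; _/_)
open import Data.Rational as ℚ using ()
open import Data.Rational.Properties using (≤-trans)
open RationalArithmetic using (K+4n≤68n⁴)
open DoubleStarVoting using (module DoubleStarChain)

lemma7 : ∃[ C ] ∃[ N ] ((n : ℕ) → N ≤ n → (c : Config (suc (suc (n + n)))) → (t : ℕ) →
           ℚ._≤_ (Voting.partialET (doubleStar n) t c) (+ (C * n ^ 4) / 1))
lemma7 = 68 , 1 , bound
  where
  bound : (n : ℕ) → 1 ≤ n → (c : Config (suc (suc (n + n)))) → (t : ℕ) →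
          ℚ._≤_ (Voting.partialET (doubleStar n) t c) (+ (68 * n ^ 4) / 1)
  bound (suc m) (s≤s z≤n) c t = ≤-trans (DoubleStarChain.partialET≤K+4n (suc m) t c) (K+4n≤68n⁴ m)
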